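{- For every subring $R$ of $\mathbb Q$ there exists a base sequence $\vec a$ with $R=\mathbb Q_{\vec a}$.
   Context: $\mathbb N=\{1,2,\dots\}$. A base sequence is a sequence $\vec a=(a_n)_{n\in\mathbb N}$ with $a_n\in\mathbb N$ and $a_n\ge 2$ for all $n$. Let $\mathrm{pr}(\vec a)$ be the set of primes $p$ such that $p\mid a_n$ for all but finitely many $n$. Define $\mathbb Q_{\vec a}=\{k/l : k\in\mathbb Z,\ l\in\mathbb N,\ \text{every prime dividing } l \text{ belongs to } \mathrm{pr}(\vec a)\}$. -}

module Defs where

open import Data.Nat using (ℕ; suc; _≤_; _≥_)
open import Data.Nat.Divisibility using (_∣_)
open import Data.Nat.Primality using (Prime)
open import Data.Integer using (ℤ)
open import Data.Rational using (ℚ; _/_; _+_; _*_; -_; 0ℚ; 1ℚ)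
open import Data.Product using (Σ; _×_; ∃; ∃-syntax)
open import Relation.Binary.PropositionalEquality using (_≡_)

-- A sequence indexed by ℕ = {0,1,...} (shift of the paper's {1,2,...} indexing;
-- irrelevant for "all but finitely many").
Seq : Set
Seq = ℕ → ℕ

IsBaseSeq : Seq → Set
IsBaseSeq a = ∀ n → 2 ≤ a n

InPr : Seq → ℕ → Set
InPr a p = Prime p × ∃[ N ] (∀ n → n ≥ N → p ∣ a n)

InQa : Seq → ℚ → Set
InQa a q = ∃[ k ] ∃[ m ] ((q ≡ k / suc m) × (∀ p → Prime p → p ∣ suc m → InPr a p))

record IsSubring (R : ℚ → Set) : Set where
  field
    has-0 : R 0ℚ
    has-1 : R 1ℚ
    +-closed : ∀ {x y} → R x → R y → R (x + y)
    *-closed : ∀ {x y} → R x → R y → R (x * y)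
    neg-closed : ∀ {x} → R x → R (- x)

{-# OPTIONS --safe #-}
-- Let S be the set of positive n with 1/n ∈ R (decidable by excluded middle) and put
-- a n = (∏ of the j ≤ n lying in S) · (n + 2).  A prime divides almost all a n iff it
-- divides some element of S: the factors n + 2 and n + 3 of consecutive terms are
-- coprime.  Since S is closed under divisors, pr(a) is the set of primes p with 1/p ∈ R.
-- Finally k/l in lowest terms lies in R iff 1/l does (Bézout), iff 1/p ∈ R for every
-- prime p ∣ l (factorise l), so R = ℚ_a.
module Submission where

open import Axiom.ExcludedMiddle using (ExcludedMiddle)
open import Data.Empty using (⊥)
open import Data.Integer as ℤ using (+_; -[1+_]; ∣_∣)
import Data.Integer.Properties as ℤ
open import Data.Integer.Tactic.RingSolver using (solve-∀)
open import Data.List using (_∷_)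
open import Data.List.Relation.Unary.All using (All; []; _∷_; tabulate; lookup)
open import Data.Nat as ℕ using (ℕ; zero; suc; _≤_; _<_; z≤n; s≤s)
open import Data.Nat.Coprimality using (Coprime; coprime-Bézout; recompute)
open import Data.Nat.Divisibility
  using (_∣_; divides; ∣-trans; ∣-refl; ∣1⇒≡1; 0∣⇒≡0; ∣m+n∣m⇒∣n; ∣m⇒∣m*n; ∣n⇒∣m*n)
import Data.Nat.GCD as GCD
open import Data.Nat.ListAction using (product)
open import Data.Nat.ListAction.Properties using (∈⇒∣product)
open import Data.Nat.Primality using (Prime; euclidsLemma; ¬prime[1])
open import Data.Nat.Primality.Factorisation using (factorise)
import Data.Nat.Properties as ℕ
open import Data.Product using (_×_; _,_; ∃-syntax; ∃₂)
open import Data.Rational using (ℚ; mkℚ; ↧ₙ_; _/_; _+_; _*_; toℚᵘ)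
open import Data.Rational.Properties
  using (fromℚᵘ-cong; toℚᵘ-fromℚᵘ; toℚᵘ-injective; toℚᵘ-homo-*; toℚᵘ-homo-+; ↥p/↧p≡p; /-cong)
import Data.Rational.Unnormalised as ℚᵘ
import Data.Rational.Unnormalised.Properties as ℚᵘ
open import Data.Sum using (inj₁; inj₂)
open import Function.Bundles using (_⇔_; mk⇔)
open import Level using (0ℓ)
open import Relation.Binary.PropositionalEquality
open import Relation.Nullary using (¬_; yes; no; contradiction)
open import Relation.Unary using (Decidable)

open import Defs

*≡*⇒/≡/ : ∀ i j m n → i ℤ.* + suc n ≡ j ℤ.* + suc m → i / suc m ≡ j / suc n
*≡*⇒/≡/ i j m n eq = fromℚᵘ-cong {ℚᵘ.mkℚᵘ i m} {ℚᵘ.mkℚᵘ j n} (ℚᵘ.*≡* eq)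

private
  toℚᵘ-/ : ∀ i n → toℚᵘ (i / suc n) ℚᵘ.≃ ℚᵘ.mkℚᵘ i n
  toℚᵘ-/ i n = toℚᵘ-fromℚᵘ (ℚᵘ.mkℚᵘ i n)

i/m*j/n≡ij/mn : ∀ i j m n → (i / suc m) * (j / suc n) ≡ (i ℤ.* j) / (suc m ℕ.* suc n)
i/m*j/n≡ij/mn i j m n = toℚᵘ-injective (ℚᵘ.≃-trans (toℚᵘ-homo-* (i / suc m) (j / suc n))
  (ℚᵘ.≃-trans (ℚᵘ.*-cong (toℚᵘ-/ i m) (toℚᵘ-/ j n)) (ℚᵘ.≃-sym (toℚᵘ-/ (i ℤ.* j) _))))

i/m+j/n≡[in+jm]/mn : ∀ i j m n →
  (i / suc m) + (j / suc n) ≡ (i ℤ.* + suc n ℤ.+ j ℤ.* + suc m) / (suc m ℕ.* suc n)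
i/m+j/n≡[in+jm]/mn i j m n = toℚᵘ-injective (ℚᵘ.≃-trans (toℚᵘ-homo-+ (i / suc m) (j / suc n))
  (ℚᵘ.≃-trans (ℚᵘ.+-cong (toℚᵘ-/ i m) (toℚᵘ-/ j n)) (ℚᵘ.≃-sym (toℚᵘ-/ _ _))))

i/1*j/n≡ij/n : ∀ i j n → (i / 1) * (j / suc n) ≡ (i ℤ.* j) / suc n
i/1*j/n≡ij/n i j n = trans (i/m*j/n≡ij/mn i j 0 n) (/-cong {i ℤ.* j} refl (ℕ.*-identityˡ (suc n)))

i/1+j/n≡[in+j]/n : ∀ i j n → (i / 1) + (j / suc n) ≡ (i ℤ.* + suc n ℤ.+ j) / suc n
i/1+j/n≡[in+j]/n i j n = trans (i/m+j/n≡[in+jm]/mn i j 0 n)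
  (/-cong (cong (λ k → i ℤ.* + suc n ℤ.+ k) (ℤ.*-identityʳ j)) (ℕ.*-identityˡ (suc n)))

private
  -yn+xm≡1 : ∀ x y m n → 1 ℕ.+ y ℕ.* n ≡ x ℕ.* m → ℤ.- + y ℤ.* + n ℤ.+ + x ℤ.* + m ≡ + 1
  -yn+xm≡1 x y m n eq = begin
    ℤ.- + y ℤ.* + n ℤ.+ + x ℤ.* + m       ≡⟨ cong₂ ℤ._+_ (ℤ.neg-distribˡ-* (+ y) (+ n)) (ℤ.pos-* x m) ⟨
    ℤ.- yn ℤ.+ + (x ℕ.* m)                ≡⟨ cong (λ k → ℤ.- yn ℤ.+ + k) eq ⟨
    ℤ.- yn ℤ.+ + (1 ℕ.+ y ℕ.* n)          ≡⟨ cong (λ k → ℤ.- yn ℤ.+ (+ 1 ℤ.+ k)) (ℤ.pos-* y n) ⟩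
    ℤ.- yn ℤ.+ (+ 1 ℤ.+ yn)               ≡⟨ cancel yn ⟩
    + 1                                   ∎
    where
    open ≡-Reasoning
    yn = + y ℤ.* + n
    cancel : ∀ u → ℤ.- u ℤ.+ (+ 1 ℤ.+ u) ≡ + 1
    cancel = solve-∀

bézout-ℕ : ∀ {m n} → Coprime m n → ∃₂ λ x y → x ℤ.* + n ℤ.+ y ℤ.* + m ≡ + 1
bézout-ℕ {m} {n} c with coprime-Bézout c
... | GCD.Bézout.+- x y eq = ℤ.- + y , + x , -yn+xm≡1 x y m n eq
... | GCD.Bézout.-+ x y eq = + y , ℤ.- + x , trans (ℤ.+-comm (+ y ℤ.* + n) _) (-yn+xm≡1 y x n m eq)

bézout-ℤ : ∀ {i n} → Coprime ∣ i ∣ n → ∃₂ λ x y → x ℤ.* + n ℤ.+ y ℤ.* i ≡ + 1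
bézout-ℤ {i} {n} c with bézout-ℕ c | ℤ.+∣i∣≡i⊎+∣i∣≡-i i
... | x , y , eq | inj₁ +∣i∣≡i  = x , y , subst (λ k → x ℤ.* + n ℤ.+ y ℤ.* k ≡ + 1) +∣i∣≡i eq
... | x , y , eq | inj₂ +∣i∣≡-i = x , ℤ.- y , trans (cong (λ k → x ℤ.* + n ℤ.+ k) -y*i≡y*∣i∣) eq
  where
  -y*i≡y*∣i∣ : ℤ.- y ℤ.* i ≡ y ℤ.* + ∣ i ∣
  -y*i≡y*∣i∣ = trans (sym (ℤ.neg-distribˡ-* y i))
    (trans (ℤ.neg-distribʳ-* y i) (cong (y ℤ.*_) (sym +∣i∣≡-i)))

Inverts : (ℚ → Set) → ℕ → Set
Inverts R zero    = ⊥
Inverts R (suc n) = R (+ 1 / suc n)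

module SubringProperties {R : ℚ → Set} (isSubring : IsSubring R) where
  open IsSubring isSubring

  ℕ⊆R : ∀ n → R (+ n / 1)
  ℕ⊆R zero    = has-0
  ℕ⊆R (suc n) = subst R (i/1+j/n≡[in+j]/n (+ 1) (+ n) 0) (+-closed has-1 (ℕ⊆R n))

  ℤ⊆R : ∀ i → R (i / 1)
  ℤ⊆R (+ n)    = ℕ⊆R n
  ℤ⊆R -[1+ n ] = neg-closed (ℕ⊆R (suc n))

  /∈R : ∀ i n → Inverts R (suc n) → R (i / suc n)
  /∈R i n r = subst R (trans (i/1*j/n≡ij/n i (+ 1) n) (/-cong (ℤ.*-identityʳ i) refl))
    (*-closed (ℤ⊆R i) r)

  inverts-∣ : ∀ {m n} → m ∣ n → Inverts R n → Inverts R m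
  inverts-∣ {zero}  {suc n} 0∣n _ = contradiction (0∣⇒≡0 0∣n) ℕ.1+n≢0
  inverts-∣ {suc m} {suc n} (divides c n≡cm) r =
    subst R (trans (i/1*j/n≡ij/n (+ c) (+ 1) n) (*≡*⇒/≡/ (+ c ℤ.* + 1) (+ 1) n m cross))
      (*-closed (ℤ⊆R (+ c)) r)
    where
    open ≡-Reasoning
    cross : + c ℤ.* + 1 ℤ.* + suc m ≡ + 1 ℤ.* + suc n
    cross = begin
      + c ℤ.* + 1 ℤ.* + suc m  ≡⟨ cong (ℤ._* + suc m) (ℤ.*-identityʳ (+ c)) ⟩
      + c ℤ.* + suc m          ≡⟨ ℤ.pos-* c (suc m) ⟨
      + (c ℕ.* suc m)          ≡⟨ cong +_ n≡cm ⟨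
      + suc n                  ≡⟨ ℤ.*-identityˡ (+ suc n) ⟨
      + 1 ℤ.* + suc n          ∎

  inverts-* : ∀ {m n} → Inverts R m → Inverts R n → Inverts R (m ℕ.* n)
  inverts-* {suc m} {suc n} r s = subst R (i/m*j/n≡ij/mn (+ 1) (+ 1) m n) (*-closed r s)

  inverts-product : ∀ {ns} → All (Inverts R) ns → Inverts R (product ns)
  inverts-product          []       = has-1
  inverts-product {n ∷ ns} (r ∷ rs) = inverts-* {n} {product ns} r (inverts-product rs)

  inverts-primeDivisors⇒inverts : ∀ n .{{_ : ℕ.NonZero n}} →
    (∀ {p} → Prime p → p ∣ n → Inverts R p) → Inverts R n
  inverts-primeDivisors⇒inverts n hyp with factorise n
  ... | record { factors = ps ; isFactorisation = n≡∏ps ; factorsPrime = primes } =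
    subst (Inverts R) (sym n≡∏ps) (inverts-product (tabulate λ p∈ps →
      hyp (lookup primes p∈ps) (subst (_ ∣_) (sym n≡∏ps) (∈⇒∣product p∈ps))))

  inverts-denominator : ∀ {q} → R q → Inverts R (↧ₙ q)
  inverts-denominator {q@(mkℚ i d coprime)} q∈R with bézout-ℤ (recompute coprime)
  ... | x , y , bézout = subst R x+y*q≡1/d
    (+-closed (ℤ⊆R x) (*-closed (ℤ⊆R y) (subst R (sym (↥p/↧p≡p q)) q∈R)))
    where
    x+y*q≡1/d : x / 1 + (y / 1) * (i / suc d) ≡ + 1 / suc d
    x+y*q≡1/d = trans (cong (λ r → x / 1 + r) (i/1*j/n≡ij/n y i d))
      (trans (i/1+j/n≡[in+j]/n x (y ℤ.* i) d) (/-cong bézout refl))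

private
  prime∤1 : ∀ {p} → Prime p → ¬ p ∣ 1
  prime∤1 p-prime p∣1 = ¬prime[1] (subst Prime (∣1⇒≡1 p∣1) p-prime)

module PartialProducts {S : ℕ → Set} (S? : Decidable S) where

  DividesSomeMember : ℕ → Set
  DividesSomeMember p = ∃[ k ] (S (suc k) × p ∣ suc k)

  factor : ℕ → ℕ
  factor k with S? (suc k)
  ... | yes _ = suc k
  ... | no  _ = 1

  partialProduct : ℕ → ℕ
  partialProduct zero    = 1
  partialProduct (suc n) = factor n ℕ.* partialProduct n

  baseSeq : Seq
  baseSeq n = partialProduct n ℕ.* (2 ℕ.+ n)

  1≤factor : ∀ k → 1 ≤ factor k
  1≤factor k with S? (suc k)
  ... | yes _ = s≤s z≤n
  ... | no  _ = s≤s z≤n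

  1≤partialProduct : ∀ n → 1 ≤ partialProduct n
  1≤partialProduct zero    = s≤s z≤n
  1≤partialProduct (suc n) = ℕ.*-mono-≤ (1≤factor n) (1≤partialProduct n)

  baseSeq-isBaseSeq : IsBaseSeq baseSeq
  baseSeq-isBaseSeq n = ℕ.*-mono-≤ (1≤partialProduct n) (ℕ.m≤m+n 2 n)

  ∣factor : ∀ {k} → S (suc k) → suc k ∣ factor k
  ∣factor {k} s with S? (suc k)
  ... | yes _ = ∣-refl
  ... | no ¬s = contradiction s ¬s

  ∣partialProduct : ∀ {k n} → S (suc k) → k < n → suc k ∣ partialProduct n
  ∣partialProduct {k} {suc n} s (s≤s k≤n) with k ℕ.≟ n
  ... | yes refl = ∣m⇒∣m*n (partialProduct n) (∣factor s)
  ... | no  k≢n  = ∣n⇒∣m*n (factor n) (∣partialProduct s (ℕ.≤∧≢⇒< k≤n k≢n))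

  prime∣factor⇒ : ∀ {p} k → Prime p → p ∣ factor k → S (suc k) × p ∣ suc k
  prime∣factor⇒ k p-prime p∣ with S? (suc k)
  ... | yes s = s , p∣
  ... | no  _ = contradiction p∣ (prime∤1 p-prime)

  prime∣partialProduct⇒ : ∀ {p} n → Prime p → p ∣ partialProduct n → DividesSomeMember p
  prime∣partialProduct⇒ zero    p-prime p∣1 = contradiction p∣1 (prime∤1 p-prime)
  prime∣partialProduct⇒ (suc n) p-prime p∣ with euclidsLemma (factor n) (partialProduct n) p-prime p∣
  ... | inj₁ p∣factor = n , prime∣factor⇒ n p-prime p∣factor
  ... | inj₂ p∣rest   = prime∣partialProduct⇒ n p-prime p∣rest

  InPr-baseSeq⇒ : ∀ {p} → InPr baseSeq p → DividesSomeMember p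
  InPr-baseSeq⇒ {p} (p-prime , N , p∣a)
    with euclidsLemma (partialProduct N) (2 ℕ.+ N) p-prime (p∣a N ℕ.≤-refl)
       | euclidsLemma (partialProduct (suc N)) (3 ℕ.+ N) p-prime (p∣a (suc N) (ℕ.n≤1+n N))
  ... | inj₁ p∣P   | _          = prime∣partialProduct⇒ N p-prime p∣P
  ... | _          | inj₁ p∣P   = prime∣partialProduct⇒ (suc N) p-prime p∣P
  ... | inj₂ p∣2+N | inj₂ p∣3+N = contradiction
    (∣m+n∣m⇒∣n (subst (p ∣_) (ℕ.+-comm 1 (2 ℕ.+ N)) p∣3+N) p∣2+N) (prime∤1 p-prime)

  ⇒InPr-baseSeq : ∀ {p} → Prime p → DividesSomeMember p → InPr baseSeq p
  ⇒InPr-baseSeq p-prime (k , s , p∣k) =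
    p-prime , suc k , λ n k<n → ∣-trans p∣k (∣m⇒∣m*n (2 ℕ.+ n) (∣partialProduct s k<n))

module SubringAsℚₐ {R : ℚ → Set} (isSubring : IsSubring R) (inverts? : Decidable (Inverts R)) where
  open SubringProperties isSubring
  open PartialProducts inverts? public using (baseSeq; baseSeq-isBaseSeq)
  open PartialProducts inverts? using (InPr-baseSeq⇒; ⇒InPr-baseSeq)

  InPr⇒inverts : ∀ {p} → InPr baseSeq p → Inverts R p
  InPr⇒inverts p∈pr with InPr-baseSeq⇒ p∈pr
  ... | _ , k∈R⁻¹ , p∣k = inverts-∣ p∣k k∈R⁻¹

  inverts⇒InPr : ∀ {p} → Prime p → Inverts R p → InPr baseSeq p
  inverts⇒InPr {suc p} p-prime p∈R⁻¹ = ⇒InPr-baseSeq p-prime (p , p∈R⁻¹ , ∣-refl)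

  R⊆ℚₐ : ∀ q → R q → InQa baseSeq q
  R⊆ℚₐ q@(mkℚ i d _) q∈R = i , d , sym (↥p/↧p≡p q) , λ _ p-prime p∣d →
    inverts⇒InPr p-prime (inverts-∣ p∣d (inverts-denominator q∈R))

  ℚₐ⊆R : ∀ q → InQa baseSeq q → R q
  ℚₐ⊆R _ (i , m , refl , primes∈pr) = /∈R i m
    (inverts-primeDivisors⇒inverts (suc m) λ p-prime p∣m → InPr⇒inverts (primes∈pr _ p-prime p∣m))

proposition2p6 : ExcludedMiddle 0ℓ → (R : ℚ → Set) → IsSubring R →
    ∃[ a ] (IsBaseSeq a × (∀ q → R q ⇔ InQa a q))
proposition2p6 em R isSubring = baseSeq , baseSeq-isBaseSeq , λ q → mk⇔ (R⊆ℚₐ q) (ℚₐ⊆R q)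
  where open SubringAsℚₐ isSubring (λ _ → em)
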